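{- Let $(A,\mathbf{C})$ be a closure algebra in which $A$ is a complete Boolean algebra. Define, for each finite non-empty $\varGamma\subseteq A$, $$\mathbf{C}^t\varGamma=\bigvee\Big\{a\in A:\ a\leq \textstyle\bigwedge_{\gamma\in\varGamma}\mathbf{C}(\gamma\land a)\Big\}.$$ Then $(A,\mathbf{C}^t)$ is a tangled closure algebra whose induced closure operator is $\mathbf{C}$ (i.e. $\mathbf{C}^t\{a\}=\mathbf{C}a$ for all $a$), and it is the unique tangled closure operator on $A$ inducing $\mathbf{C}$.
   Context: Let $A$ be a Boolean algebra with operations $\land,\lor,-,0,1$; write $a\Rightarrow b=-a\lor b$. A closure operator on $A$ is a map $\mathbf{C}:A\to A$ with $\mathbf{C}(a\lor b)=\mathbf{C}a\lor\mathbf{C}b$, $\mathbf{C}0=0$, $a\leq\mathbf{C}a=\mathbf{C}\mathbf{C}a$; $(A,\mathbf{C})$ is then a closure algebra, and $\mathbf{I}a=-\mathbf{C}-a$ is its interior operator. Let $\mathcal{P}_{fin}A$ be the set of finite non-empty subsets of $A$. Given $\mathbf{C}^t:\mathcal{P}_{fin}A\to A$, the induced unary map is $a\mapsto\mathbf{C}^t\{a\}$ with dual $a\mapsto-\mathbf{C}^t\{ -a\}$. $(A,\mathbf{C}^t)$ is a tangled closure algebra if the induced unary map (call it $\mathbf{C}$, dual $\mathbf{I}$) is a closure operator and for all $\varGamma\in\mathcal{P}_{fin}A$ and $a\in A$: (Fix) $\mathbf{C}^t\varGamma\leq\bigwedge_{\gamma\in\varGamma}\mathbf{C}(\gamma\land\mathbf{C}^t\varGamma)$;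 (Ind) $\mathbf{I}\big(a\Rightarrow\bigwedge_{\gamma\in\varGamma}\mathbf{C}(\gamma\land a)\big)\land a\leq\mathbf{C}^t\varGamma$. -}

module Defs where

open import Level using (_⊔_)
open import Algebra.Lattice.Bundles using (BooleanAlgebra)
open import Data.List using (List; []; _∷_)
open import Data.List.NonEmpty using (List⁺; _∷_; [_])
open import Data.List.Relation.Unary.Any using (Any)
open import Data.Product using (_×_)
open import Function.Bundles using (_⇔_)

module _ {c ℓ} (B : BooleanAlgebra c ℓ) where
  open BooleanAlgebra B

  _≤_ : Carrier → Carrier → Set ℓ
  x ≤ y = (x ∧ y) ≈ x

  _⇒_ : Carrier → Carrier → Carrier
  a ⇒ b = (¬ a) ∨ b

  record Complete : Set (c ⊔ Level.suc ℓ) where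
    field
      ⋁     : (Carrier → Set ℓ) → Carrier
      ⋁-ub  : ∀ (P : Carrier → Set ℓ) x → P x → x ≤ ⋁ P
      ⋁-lub : ∀ (P : Carrier → Set ℓ) y → (∀ x → P x → x ≤ y) → ⋁ P ≤ y

  record IsClosure (C : Carrier → Carrier) : Set (c ⊔ ℓ) where
    field
      cong   : ∀ {a b} → a ≈ b → C a ≈ C b
      C-∨    : ∀ a b → C (a ∨ b) ≈ (C a ∨ C b)
      C-⊥    : C ⊥ ≈ ⊥
      C-incr : ∀ a → a ≤ C a
      C-idem : ∀ a → C (C a) ≈ C a

  interior : (Carrier → Carrier) → Carrier → Carrier
  interior C a = ¬ C (¬ a)

  meetMap : (Carrier → Carrier) → List⁺ Carrier → Carrier
  meetMap f (x ∷ xs) = go x xs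
    where
    go : Carrier → List Carrier → Carrier
    go y []       = f y
    go y (z ∷ zs) = f y ∧ go z zs

  _∈⁺_ : Carrier → List⁺ Carrier → Set (c ⊔ ℓ)
  x ∈⁺ (y ∷ ys) = Any (x ≈_) (y ∷ ys)

  induced : (List⁺ Carrier → Carrier) → Carrier → Carrier
  induced Ct a = Ct [ a ]

  -- (A, Ct) is a tangled closure algebra.  Finite non-empty subsets are
  -- represented by non-empty lists; Ct is required to be a well-defined
  -- function of the underlying finite set (WellDef).
  record IsTangled (Ct : List⁺ Carrier → Carrier) : Set (c ⊔ ℓ) where
    field
      WellDef : ∀ Γ Δ → (∀ x → (x ∈⁺ Γ) ⇔ (x ∈⁺ Δ)) → Ct Γ ≈ Ct Δ
      closure : IsClosure (induced Ct)
      Fix     : ∀ Γ → Ct Γ ≤ meetMap (λ γ → induced Ct (γ ∧ Ct Γ)) Γ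
      Ind     : ∀ Γ a →
                (interior (induced Ct) (a ⇒ meetMap (λ γ → induced Ct (γ ∧ a)) Γ) ∧ a) ≤ Ct Γ

  Ctangle : Complete → (Carrier → Carrier) → List⁺ Carrier → Carrier
  Ctangle comp C Γ = Complete.⋁ comp (λ a → a ≤ meetMap (λ γ → C (γ ∧ a)) Γ)

-- Ctangle Γ is the greatest post-fixed point of the monotone map
-- a ↦ ⋀_{γ∈Γ} C (γ ∧ a), which gives (Fix) at once.  For (Ind), the element
-- x = I (a ⇒ ⋀ C (γ ∧ a)) ∧ a is itself a post-fixed point: meeting a closure
-- with an open element u satisfies C y ∧ u ≤ C (y ∧ u).  Uniqueness: (Fix) for
-- another tangled operator Ct makes Ct Γ a post-fixed point, so Ct Γ ≤ Ctangle Γ;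
-- conversely (Ind) at a = Ctangle Γ has I ⊤ = ⊤ as its first conjunct.

module Submission where

open import Defs
open import Algebra.Lattice.Bundles using (BooleanAlgebra)
open import Data.List using ([]; _∷_)
open import Data.List.NonEmpty using (List⁺; [_]; _∷_)
open import Data.List.Relation.Unary.Any using (here; there)
open import Data.Product using (_×_; _,_)
open import Function.Bundles using (module Equivalence)
import Algebra.Lattice.Properties.BooleanAlgebra as BooleanAlgebraProperties
import Algebra.Lattice.Properties.Lattice as LatticeProperties
import Relation.Binary.Lattice.Bundles as OrderTheoretic
import Relation.Binary.Lattice.Properties.JoinSemilattice as JoinSemilatticeProperties
import Relation.Binary.Lattice.Properties.MeetSemilattice as MeetSemilatticeProperties
import Relation.Binary.Reasoning.PartialOrder as PosetReasoning

module _ {c ℓ} (B : BooleanAlgebra c ℓ) where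
  open BooleanAlgebra B
  open BooleanAlgebraProperties B using (∧-identityʳ; ∨-identityˡ; ¬⊥≈⊤; ¬⊤≈⊥; ¬-involutive; deMorgan₁)

  orderLattice : OrderTheoretic.Lattice c ℓ ℓ
  orderLattice = LatticeProperties.∨-∧-orderTheoreticLattice lattice

  open OrderTheoretic.Lattice orderLattice
    using (poset; x∧y≤x; x∧y≤y; ∧-greatest; x≤x∨y; y≤x∨y; ≤-respˡ-≈; ≤-respʳ-≈)
    renaming (_≤_ to _⊑_; refl to ⊑-refl; reflexive to ⊑-reflexive; trans to ⊑-trans; antisym to ⊑-antisym)
  open JoinSemilatticeProperties (OrderTheoretic.Lattice.joinSemilattice orderLattice)
    using (∨-monotonic; x≤y⇒x∨y≈y)
  open MeetSemilatticeProperties (OrderTheoretic.Lattice.meetSemilattice orderLattice)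
    using (∧-monotonic)
  open PosetReasoning poset

  -- Defs orders by x ∧ y ≈ x, the library's natural order by x ≈ x ∧ y.
  ≤⇒⊑ : ∀ {x y} → x ∧ y ≈ x → x ⊑ y
  ≤⇒⊑ = sym

  ⊑⇒≤ : ∀ {x y} → x ⊑ y → x ∧ y ≈ x
  ⊑⇒≤ = sym

  x⊑⊤ : ∀ x → x ⊑ ⊤
  x⊑⊤ x = sym (∧-identityʳ x)

  ¬-antitone : ∀ {x y} → x ⊑ y → ¬ y ⊑ ¬ x
  ¬-antitone {x} {y} x⊑y = begin
    ¬ y         ≤⟨ y≤x∨y (¬ x) (¬ y) ⟩
    ¬ x ∨ ¬ y   ≈⟨ deMorgan₁ x y ⟨
    ¬ (x ∧ y)   ≈⟨ ¬-cong x⊑y ⟨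
    ¬ x         ∎

  x⊑y∨z⇒x∧¬z⊑y : ∀ {x y z} → x ⊑ y ∨ z → x ∧ ¬ z ⊑ y
  x⊑y∨z⇒x∧¬z⊑y {x} {y} {z} x⊑y∨z = begin
    x ∧ ¬ z                ≤⟨ ∧-monotonic x⊑y∨z ⊑-refl ⟩
    (y ∨ z) ∧ ¬ z          ≈⟨ ∧-distribʳ-∨ (¬ z) y z ⟩
    (y ∧ ¬ z) ∨ (z ∧ ¬ z)  ≈⟨ ∨-congˡ (∧-complementʳ z) ⟩
    (y ∧ ¬ z) ∨ ⊥          ≈⟨ ∨-comm _ ⊥ ⟩
    ⊥ ∨ (y ∧ ¬ z)          ≈⟨ ∨-identityˡ _ ⟩
    y ∧ ¬ z                ≤⟨ x∧y≤x y (¬ z) ⟩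
    y                      ∎

  ∧-modusPonens : ∀ x y → x ∧ (¬ x ∨ y) ⊑ y
  ∧-modusPonens x y = begin
    x ∧ (¬ x ∨ y)          ≈⟨ ∧-distribˡ-∨ x (¬ x) y ⟩
    (x ∧ ¬ x) ∨ (x ∧ y)    ≈⟨ ∨-congʳ (∧-complementʳ x) ⟩
    ⊥ ∨ (x ∧ y)            ≈⟨ ∨-identityˡ _ ⟩
    x ∧ y                  ≤⟨ x∧y≤y x y ⟩
    y                      ∎

  x⊑y⇒¬x∨y≈⊤ : ∀ {x y} → x ⊑ y → ¬ x ∨ y ≈ ⊤
  x⊑y⇒¬x∨y≈⊤ {x} {y} x⊑y = ⊑-antisym (x⊑⊤ _) (begin
    ⊤        ≈⟨ ∨-complementˡ x ⟨
    ¬ x ∨ x  ≤⟨ ∨-monotonic ⊑-refl x⊑y ⟩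
    ¬ x ∨ y  ∎)

  meetMap-lift : ∀ {x} f g Γ → (∀ γ → x ⊑ f γ → x ⊑ g γ) →
                 x ⊑ meetMap B f Γ → x ⊑ meetMap B g Γ
  meetMap-lift {x} f g (y ∷ zs) h = go y zs
    where
    go : ∀ y zs → x ⊑ meetMap B f (y ∷ zs) → x ⊑ meetMap B g (y ∷ zs)
    go y []       x⊑⋀f = h y x⊑⋀f
    go y (z ∷ zs) x⊑⋀f =
      ∧-greatest (h y (⊑-trans x⊑⋀f (x∧y≤x _ _))) (go z zs (⊑-trans x⊑⋀f (x∧y≤y _ _)))

  meetMap-greatest : ∀ {x} f Γ → (∀ γ → _∈⁺_ B γ Γ → x ⊑ f γ) → x ⊑ meetMap B f Γ
  meetMap-greatest {x} f (y ∷ zs) = go y zs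
    where
    go : ∀ y zs → (∀ γ → _∈⁺_ B γ (y ∷ zs) → x ⊑ f γ) → x ⊑ meetMap B f (y ∷ zs)
    go y []       h = h y (here refl)
    go y (z ∷ zs) h = ∧-greatest (h y (here refl)) (go z zs (λ γ γ∈ → h γ (there γ∈)))

  meetMap-lowerBound : ∀ f → (∀ {a b} → a ≈ b → f a ≈ f b) →
                       ∀ {γ} Γ → _∈⁺_ B γ Γ → meetMap B f Γ ⊑ f γ
  meetMap-lowerBound f f-cong {γ} (y ∷ zs) = go y zs
    where
    go : ∀ y zs → _∈⁺_ B γ (y ∷ zs) → meetMap B f (y ∷ zs) ⊑ f γ
    go y []       (here γ≈y) = ⊑-reflexive (f-cong (sym γ≈y))
    go y (z ∷ zs) (here γ≈y) = ⊑-trans (x∧y≤x _ _) (⊑-reflexive (f-cong (sym γ≈y)))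
    go y (z ∷ zs) (there γ∈) = ⊑-trans (x∧y≤y _ _) (go z zs γ∈)

  tangleMeet : (Carrier → Carrier) → List⁺ Carrier → Carrier → Carrier
  tangleMeet D Γ a = meetMap B (λ γ → D (γ ∧ a)) Γ

  tangleMeet-resp : ∀ {D C} → (∀ a → D a ≈ C a) → ∀ Γ a → tangleMeet D Γ a ≈ tangleMeet C Γ a
  tangleMeet-resp D≈C Γ a = ⊑-antisym
    (meetMap-lift _ _ Γ (λ γ p → ≤-respʳ-≈ (D≈C _) p) ⊑-refl)
    (meetMap-lift _ _ Γ (λ γ p → ≤-respʳ-≈ (sym (D≈C _)) p) ⊑-refl)

  interior-resp : ∀ {D C} → (∀ a → D a ≈ C a) → ∀ b → interior B D b ≈ interior B C b
  interior-resp D≈C b = ¬-cong (D≈C (¬ b))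

  IsClosure-resp : ∀ {D C} → (∀ a → D a ≈ C a) → IsClosure B C → IsClosure B D
  IsClosure-resp {D} {C} D≈C isC = record
    { cong   = λ {a} {b} a≈b → trans (D≈C a) (trans (cong a≈b) (sym (D≈C b)))
    ; C-∨    = λ a b → trans (D≈C _) (trans (C-∨ a b) (∨-cong (sym (D≈C a)) (sym (D≈C b))))
    ; C-⊥    = trans (D≈C ⊥) C-⊥
    ; C-incr = λ a → ⊑⇒≤ (≤-respʳ-≈ (sym (D≈C a)) (≤⇒⊑ (C-incr a)))
    ; C-idem = λ a → trans (D≈C _) (trans (cong (D≈C a)) (trans (C-idem a) (sym (D≈C a))))
    }
    where open IsClosure isC

  module ClosureAlgebra {C : Carrier → Carrier} (isC : IsClosure B C) where
    open IsClosure isC renaming (cong to C-cong)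

    C-monotone : ∀ {a b} → a ⊑ b → C a ⊑ C b
    C-monotone {a} {b} a⊑b = begin
      C a          ≤⟨ x≤x∨y (C a) (C b) ⟩
      C a ∨ C b    ≈⟨ C-∨ a b ⟨
      C (a ∨ b)    ≈⟨ C-cong (x≤y⇒x∨y≈y a⊑b) ⟩
      C b          ∎

    interior-deflationary : ∀ b → interior B C b ⊑ b
    interior-deflationary b = ≤-respʳ-≈ (¬-involutive b) (¬-antitone (≤⇒⊑ (C-incr (¬ b))))

    interior-⊤ : ∀ {b} → b ≈ ⊤ → interior B C b ≈ ⊤
    interior-⊤ b≈⊤ = trans (¬-cong (trans (C-cong (trans (¬-cong b≈⊤) ¬⊤≈⊥)) C-⊥)) ¬⊥≈⊤

    interior-implication-resp : ∀ {D} → (∀ a → D a ≈ C a) → ∀ Γ a →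
      interior B D (¬ a ∨ tangleMeet D Γ a) ≈ interior B C (¬ a ∨ tangleMeet C Γ a)
    interior-implication-resp D≈C Γ a = trans (interior-resp D≈C _)
      (¬-cong (C-cong (¬-cong (∨-congˡ (tangleMeet-resp D≈C Γ a)))))

    -- The complement of a closed k is open; splitting y along k gives
    -- C y ≤ C (y ∧ ¬ k) ∨ C k = C (y ∧ ¬ k) ∨ k.
    C-∧-open : ∀ y {k} → C k ≈ k → C y ∧ ¬ k ⊑ C (y ∧ ¬ k)
    C-∧-open y {k} k-closed = x⊑y∨z⇒x∧¬z⊑y (begin
      C y                             ≈⟨ C-cong split ⟩
      C ((y ∧ ¬ k) ∨ (y ∧ k))         ≈⟨ C-∨ _ _ ⟩
      C (y ∧ ¬ k) ∨ C (y ∧ k)         ≤⟨ ∨-monotonic ⊑-refl (C-monotone (x∧y≤y y k)) ⟩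
      C (y ∧ ¬ k) ∨ C k               ≈⟨ ∨-congˡ k-closed ⟩
      C (y ∧ ¬ k) ∨ k                 ∎)
      where
      split : y ≈ (y ∧ ¬ k) ∨ (y ∧ k)
      split = trans (sym (∧-identityʳ y))
                (trans (∧-congˡ (sym (∨-complementˡ k))) (∧-distribˡ-∨ y (¬ k) k))

    tangleMeet-monotone : ∀ Γ {a b} → a ⊑ b → tangleMeet C Γ a ⊑ tangleMeet C Γ b
    tangleMeet-monotone Γ a⊑b =
      meetMap-lift _ _ Γ (λ γ p → ⊑-trans p (C-monotone (∧-monotonic ⊑-refl a⊑b))) ⊑-refl

    interior-implication-postfixed : ∀ Γ a →
      let x = interior B C (¬ a ∨ tangleMeet C Γ a) ∧ a in x ⊑ tangleMeet C Γ x
    interior-implication-postfixed Γ a = meetMap-lift _ _ Γ step x⊑⋀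
      where
      u = interior B C (¬ a ∨ tangleMeet C Γ a)
      x = u ∧ a
      x⊑⋀ : x ⊑ tangleMeet C Γ a
      x⊑⋀ = begin
        u ∧ a                          ≤⟨ ∧-monotonic (interior-deflationary _) ⊑-refl ⟩
        (¬ a ∨ tangleMeet C Γ a) ∧ a     ≈⟨ ∧-comm _ a ⟩
        a ∧ (¬ a ∨ tangleMeet C Γ a)     ≤⟨ ∧-modusPonens a _ ⟩
        tangleMeet C Γ a               ∎
      step : ∀ γ → x ⊑ C (γ ∧ a) → x ⊑ C (γ ∧ x)
      step γ x⊑Cγa = begin
        x                  ≤⟨ ∧-greatest x⊑Cγa (x∧y≤x u a) ⟩
        C (γ ∧ a) ∧ u      ≤⟨ C-∧-open (γ ∧ a) (C-idem _) ⟩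
        C ((γ ∧ a) ∧ u)    ≈⟨ C-cong (trans (∧-assoc γ a u) (∧-congˡ (∧-comm a u))) ⟩
        C (γ ∧ x)          ∎

    module Tangle (comp : Complete B) where
      open Complete comp

      t : List⁺ Carrier → Carrier
      t = Ctangle B comp C

      ⊑-Ctangle : ∀ Γ {a} → a ⊑ tangleMeet C Γ a → a ⊑ t Γ
      ⊑-Ctangle Γ {a} a⊑⋀ = ≤⇒⊑ (⋁-ub _ a (⊑⇒≤ a⊑⋀))

      Ctangle-⊑ : ∀ Γ {b} → (∀ a → a ⊑ tangleMeet C Γ a → a ⊑ b) → t Γ ⊑ b
      Ctangle-⊑ Γ {b} h = ≤⇒⊑ (⋁-lub _ b (λ a p → ⊑⇒≤ (h a (≤⇒⊑ p))))

      Ctangle-postfixed : ∀ Γ → t Γ ⊑ tangleMeet C Γ (t Γ)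
      Ctangle-postfixed Γ =
        Ctangle-⊑ Γ (λ a a⊑⋀ → ⊑-trans a⊑⋀ (tangleMeet-monotone Γ (⊑-Ctangle Γ a⊑⋀)))

      Ctangle-singleton : ∀ a → t [ a ] ≈ C a
      Ctangle-singleton a = ⊑-antisym
        (Ctangle-⊑ [ a ] (λ x x⊑Cax → ⊑-trans x⊑Cax (C-monotone (x∧y≤x a x))))
        (⊑-Ctangle [ a ] (⊑-reflexive (C-cong (sym (C-incr a)))))

      Ctangle-antitone : ∀ Γ Δ → (∀ x → _∈⁺_ B x Δ → _∈⁺_ B x Γ) → t Γ ⊑ t Δ
      Ctangle-antitone Γ Δ Δ⊆Γ = Ctangle-⊑ Γ (λ a a⊑⋀ → ⊑-Ctangle Δ
        (meetMap-greatest _ Δ (λ δ δ∈Δ → ⊑-trans a⊑⋀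
          (meetMap-lowerBound _ (λ e → C-cong (∧-congʳ e)) Γ (Δ⊆Γ δ δ∈Δ)))))

      Ctangle-tangled : IsTangled B t
      Ctangle-tangled = record
        { WellDef = λ Γ Δ Γ≃Δ → ⊑-antisym
            (Ctangle-antitone Γ Δ (λ x → Equivalence.from (Γ≃Δ x)))
            (Ctangle-antitone Δ Γ (λ x → Equivalence.to (Γ≃Δ x)))
        ; closure = IsClosure-resp Ctangle-singleton isC
        ; Fix     = λ Γ → ⊑⇒≤ (≤-respʳ-≈ (sym (tangleMeet-resp Ctangle-singleton Γ (t Γ)))
                                           (Ctangle-postfixed Γ))
        ; Ind     = λ Γ a → ⊑⇒≤ (≤-respˡ-≈
            (∧-congʳ (sym (interior-implication-resp Ctangle-singleton Γ a)))
            (⊑-Ctangle Γ (interior-implication-postfixed Γ a)))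
        }

      Ctangle-unique : ∀ Ct → IsTangled B Ct → (∀ a → Ct [ a ] ≈ C a) → ∀ Γ → Ct Γ ≈ t Γ
      Ctangle-unique Ct Ct-tangled Ct≈C Γ = ⊑-antisym
        (⊑-Ctangle Γ (≤-respʳ-≈ (tangleMeet-resp Ct≈C Γ (Ct Γ)) (≤⇒⊑ (Fix Γ))))
        (≤-respˡ-≈ ⊤∧t (≤⇒⊑ (Ind Γ (t Γ))))
        where
        open IsTangled Ct-tangled
        ⊤∧t : interior B (induced B Ct) (¬ t Γ ∨ tangleMeet (induced B Ct) Γ (t Γ)) ∧ t Γ ≈ t Γ
        ⊤∧t = trans (∧-congʳ (trans (interior-implication-resp Ct≈C Γ (t Γ))
                                    (interior-⊤ (x⊑y⇒¬x∨y≈⊤ (Ctangle-postfixed Γ)))))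
                    (trans (∧-comm ⊤ (t Γ)) (∧-identityʳ (t Γ)))

theorem2p3 : ∀ {c ℓ} (B : BooleanAlgebra c ℓ) (comp : Complete B)
             (C : BooleanAlgebra.Carrier B → BooleanAlgebra.Carrier B) →
             IsClosure B C →
             IsTangled B (Ctangle B comp C)
             × (∀ a → BooleanAlgebra._≈_ B (Ctangle B comp C [ a ]) (C a))
             × (∀ (Ct : List⁺ (BooleanAlgebra.Carrier B) → BooleanAlgebra.Carrier B) →
                  IsTangled B Ct →
                  (∀ a → BooleanAlgebra._≈_ B (Ct [ a ]) (C a)) →
                  ∀ Γ → BooleanAlgebra._≈_ B (Ct Γ) (Ctangle B comp C Γ))
theorem2p3 B comp C isC = Ctangle-tangled , Ctangle-singleton , Ctangle-unique
  where open ClosureAlgebra.Tangle B isC comp
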